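{- Let \((B,\prec)\) be an abstract \(\mathcal V\)-basis. The principal ideals \(b\mapsto {\downarrow} b = \{a\in B\mid a\prec b\}\) give a small basis \(B\to\mathrm{Idl}_{\mathcal V}(B,\prec)\) for the rounded ideal completion \(\mathrm{Idl}_{\mathcal V}(B,\prec)\). In particular, \(\mathrm{Idl}_{\mathcal V}(B,\prec)\) is continuous.
   Context: We work constructively and predicatively in univalent foundations with universes and propositional truncation. \(\mathcal V\)-small: equivalent to a type in \(\mathcal V\). Directed family: inhabited index and any two indices have (there exists) a common upper index. \(\mathcal V\)-dcpo: poset with suprema of directed families indexed by types in \(\mathcal V\). Way-below: \(x\ll y\) iff for every directed \(\alpha:I\to D\), \(I:\mathcal V\), with \(y\sqsubseteq\bigsqcup\alpha\) there exists \(i\) with \(x\sqsubseteq\alpha_i\). Small basis: \(\beta:B\to D\), \(B:\mathcal V\), with each family \(\Sigma_{b:B}(\beta(b)\ll x)\to D\) (via \(\beta\)) directed with supremum \(x\), and each \(\beta(b)\ll x\) \(\mathcal V\)-small. Continuity data: to each \(x\) a type \(I_x:\mathcal V\) and directed \(\alpha_x:I_x\to D\) with supremum \(x\) and each \(\alpha_x(i)\ll x\); continuous means such data exists (truncated). Abstract \(\mathcal V\)-basis: \(B:\mathcal V\) with proposition-valued transitive \(\prec:B\to B\to\mathcal V\), such that every \(a\) has (there exists) some \(b\prec a\), and whenever \(a_1,a_2\prec b\) there exists \(a\) with \(a_1,a_2\prec a\prec b\). Ideal: subset \(I:B\to\Omega_{\mathcal V}\) that is a lower set (\(a\prec b\in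 I\Rightarrow a\in I\)) and directed (inhabited; any \(b_1,b_2\in I\) have some \(b\in I\) with \(b_1,b_2\prec b\)). \(\mathrm{Idl}_{\mathcal V}(B,\prec)\): ideals ordered by inclusion, a \(\mathcal V\)-dcpo with directed suprema given by unions. Principal ideals are ideals. -}

module Defs where

open import Level using (Level; _⊔_; suc; Setω)
open import Data.Product using (Σ; _×_; _,_; proj₁; proj₂; Σ-syntax)
open import Relation.Binary.PropositionalEquality using (_≡_)
open import Function.Bundles using (_↔_)

isProp : ∀ {ℓ} → Set ℓ → Set ℓ
isProp A = (x y : A) → x ≡ y

record PropTrunc : Setω where
  field
    ∥_∥     : ∀ {ℓ} → Set ℓ → Set ℓ
    ∣_∣     : ∀ {ℓ} {A : Set ℓ} → A → ∥ A ∥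
    ∥∥-isProp : ∀ {ℓ} {A : Set ℓ} → isProp ∥ A ∥
    ∥∥-rec  : ∀ {ℓ ℓ'} {A : Set ℓ} {P : Set ℓ'} → isProp P → (A → P) → ∥ A ∥ → P

  ∃∥ : ∀ {a b} (A : Set a) (P : A → Set b) → Set (a ⊔ b)
  ∃∥ A P = ∥ Σ A P ∥

module Generic (pt : PropTrunc) where
  open PropTrunc pt

  module Order {u t : Level} (D : Set u) (_⊑_ : D → D → Set t) where

    IsDirected : ∀ {i} {I : Set i} → (I → D) → Set (i ⊔ t)
    IsDirected {I = I} α = ∥ I ∥ × ((i j : I) → ∃∥ I (λ k → (α i ⊑ α k) × (α j ⊑ α k)))

    IsUpperBound : ∀ {i} {I : Set i} → D → (I → D) → Set (i ⊔ t)
    IsUpperBound x α = ∀ i → α i ⊑ x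

    IsSup : ∀ {i} {I : Set i} → D → (I → D) → Set (u ⊔ i ⊔ t)
    IsSup x α = IsUpperBound x α × (∀ y → IsUpperBound y α → x ⊑ y)

    IsSmall : ∀ {w} (𝓥 : Level) → Set w → Set (suc 𝓥 ⊔ w)
    IsSmall 𝓥 X = Σ[ Y ∈ Set 𝓥 ] (Y ↔ X)

    module DCPO (𝓥 : Level) (∐ : {I : Set 𝓥} (α : I → D) → IsDirected α → D) where

      _≪_ : D → D → Set (suc 𝓥 ⊔ u ⊔ t)
      x ≪ y = (I : Set 𝓥) (α : I → D) (δ : IsDirected α) → y ⊑ ∐ α δ → ∃∥ I (λ i → x ⊑ α i)

      IsSmallBasis : {B : Set 𝓥} → (B → D) → Set (suc 𝓥 ⊔ u ⊔ t)
      IsSmallBasis {B} β =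
        ((x : D) → let γ : Σ[ b ∈ B ] (β b ≪ x) → D
                       γ p = β (proj₁ p)
                   in IsDirected γ × IsSup x γ)
        × ((b : B) (x : D) → IsSmall 𝓥 (β b ≪ x))

      ContinuityData : Set (suc 𝓥 ⊔ u ⊔ t)
      ContinuityData = (x : D) → Σ[ I ∈ Set 𝓥 ] Σ[ α ∈ (I → D) ]
                         (IsDirected α × IsSup x α × ((i : I) → α i ≪ x))

      IsContinuous : Set (suc 𝓥 ⊔ u ⊔ t)
      IsContinuous = ∥ ContinuityData ∥

  record AbstractBasis (𝓥 : Level) : Set (suc 𝓥) where
    field
      B       : Set 𝓥
      _≺_     : B → B → Set 𝓥
      ≺-prop  : ∀ a b → isProp (a ≺ b)
      ≺-trans : ∀ {a b c} → a ≺ b → b ≺ c → a ≺ c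
      ≺-below : ∀ a → ∃∥ B (λ b → b ≺ a)
      ≺-interpolate : ∀ {a₁ a₂ b} → a₁ ≺ b → a₂ ≺ b →
                      ∃∥ B (λ a → (a₁ ≺ a) × (a₂ ≺ a) × (a ≺ b))

  module Idl {𝓥 : Level} (AB : AbstractBasis 𝓥) where
    open AbstractBasis AB

    record IsIdeal (I : B → Set 𝓥) : Set 𝓥 where
      field
        prop-valued : ∀ b → isProp (I b)
        lower       : ∀ {a b} → a ≺ b → I b → I a
        inhabited   : ∃∥ B I
        directed    : ∀ {b₁ b₂} → I b₁ → I b₂ → ∃∥ B (λ b → I b × (b₁ ≺ b) × (b₂ ≺ b))
    open IsIdeal

    Ideal : Set (suc 𝓥)
    Ideal = Σ[ I ∈ (B → Set 𝓥) ] IsIdeal I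

    _∈_ : B → Ideal → Set 𝓥
    b ∈ I = proj₁ I b

    _⊆_ : Ideal → Ideal → Set 𝓥
    I ⊆ J = ∀ b → b ∈ I → b ∈ J

    open Order Ideal _⊆_ public

    ∐ : {J : Set 𝓥} (α : J → Ideal) → IsDirected α → Ideal
    ∐ {J} α (inh , dir) = U , record
      { prop-valued = λ _ → ∥∥-isProp
      ; lower = λ a≺b → ∥∥-rec ∥∥-isProp (λ { (j , m) → ∣ j , lower (proj₂ (α j)) a≺b m ∣ })
      ; inhabited = ∥∥-rec ∥∥-isProp
          (λ j → ∥∥-rec ∥∥-isProp (λ { (b , m) → ∣ b , ∣ j , m ∣ ∣ }) (inhabited (proj₂ (α j))))
          inh
      ; directed = λ u₁ u₂ → ∥∥-rec ∥∥-isProp (λ { (i , m₁) → ∥∥-rec ∥∥-isProp (λ { (j , m₂) →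
          ∥∥-rec ∥∥-isProp (λ { (k , p , q) →
            ∥∥-rec ∥∥-isProp (λ { (b , mb , r₁ , r₂) → ∣ b , ∣ k , mb ∣ , r₁ , r₂ ∣ })
              (directed (proj₂ (α k)) (p _ m₁) (q _ m₂)) }) (dir i j) }) u₂ }) u₁
      }
      where
      U : B → Set 𝓥
      U b = ∃∥ J (λ j → b ∈ α j)

    open DCPO 𝓥 ∐ public

    ↓_ : B → Ideal
    ↓ b = (λ a → a ≺ b) , record
      { prop-valued = λ a → ≺-prop a b
      ; lower = ≺-trans
      ; inhabited = ≺-below b
      ; directed = λ p q → ∥∥-rec ∥∥-isProp
          (λ { (a , r₁ , r₂ , r₃) → ∣ a , r₃ , r₁ , r₂ ∣ }) (≺-interpolate p q)
      }

module Submission where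

open import Defs
open import Data.Product using (_×_; _,_; proj₁; proj₂; Σ-syntax)
open import Axiom.Extensionality.Propositional using (Extensionality)
open import Level using (Level)
open import Function.Base using (_∘_; id)
open import Function.Bundles using (_↔_; mk↔ₛ′)

-- Every ideal is the directed union of the principal ideals of its members, and
-- ↓b ≪ I holds exactly when ↓b ⊆ ↓c for some c ∈ I: the union of the ↓c is one of
-- the directed families covering I, and conversely c ∈ I ⊆ ⋃α puts c, hence all of ↓c,
-- into a single α j. The latter condition is a small proposition, and ideals are
-- rounded, so the principal ideals way below I still have union I.

module RoundedIdealCompletion (pt : PropTrunc) {𝓥 : Level} (AB : Generic.AbstractBasis pt 𝓥) where
  open PropTrunc pt
  open Generic pt
  open AbstractBasis AB
  open Idl AB
  open IsIdeal

  ∥∥-map : ∀ {a b} {A : Set a} {P : Set b} → (A → P) → ∥ A ∥ → ∥ P ∥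
  ∥∥-map f = ∥∥-rec ∥∥-isProp (∣_∣ ∘ f)

  ∥∥-bind : ∀ {a b} {A : Set a} {P : Set b} → (A → ∥ P ∥) → ∥ A ∥ → ∥ P ∥
  ∥∥-bind = ∥∥-rec ∥∥-isProp

  ↓-mono : ∀ {a b} → a ≺ b → (↓ a) ⊆ (↓ b)
  ↓-mono a≺b _ c≺a = ≺-trans c≺a a≺b

  ↓-⊆-ideal : (I : Ideal) → ∀ {b} → b ∈ I → (↓ b) ⊆ I
  ↓-⊆-ideal I b∈I _ a≺b = lower (proj₂ I) a≺b b∈I

  ∐-isUpperBound : ∀ {J : Set 𝓥} (α : J → Ideal) (δ : IsDirected α) → IsUpperBound (∐ α δ) α
  ∐-isUpperBound α δ j _ b∈αj = ∣ j , b∈αj ∣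

  ideal-rounded : (I : Ideal) → ∀ {a} → a ∈ I → ∃∥ B (λ c → c ∈ I × (a ≺ c))
  ideal-rounded I a∈I = ∥∥-map (λ { (c , c∈I , a≺c , _) → c , c∈I , a≺c })
                          (directed (proj₂ I) a∈I a∈I)

  Members : Ideal → Set 𝓥
  Members I = Σ[ c ∈ B ] c ∈ I

  ↓-members : (I : Ideal) → Members I → Ideal
  ↓-members I = ↓_ ∘ proj₁

  ↓-members-isDirected : (I : Ideal) → IsDirected (↓-members I)
  ↓-members-isDirected I = inhabited (proj₂ I) , semidirected
    where
    semidirected : ∀ p q → ∃∥ (Members I)
                     (λ r → (↓-members I p ⊆ ↓-members I r) × (↓-members I q ⊆ ↓-members I r))
    semidirected (c₁ , c₁∈I) (c₂ , c₂∈I) =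
      ∥∥-map (λ { (c , c∈I , c₁≺c , c₂≺c) → (c , c∈I) , ↓-mono c₁≺c , ↓-mono c₂≺c })
             (directed (proj₂ I) c₁∈I c₂∈I)

  ↓-members-isSup : (I : Ideal) → IsSup I (↓-members I)
  ↓-members-isSup I = (λ { (c , c∈I) → ↓-⊆-ideal I c∈I }) , least
    where
    least : ∀ J → IsUpperBound J (↓-members I) → I ⊆ J
    least J ub a a∈I = ∥∥-rec (prop-valued (proj₂ J) a)
                         (λ { (c , c∈I , a≺c) → ub (c , c∈I) a a≺c }) (ideal-rounded I a∈I)

  _◃_ : B → Ideal → Set 𝓥
  b ◃ I = ∃∥ B (λ c → c ∈ I × (↓ b) ⊆ (↓ c))

  ◃⇒≪ : ∀ {b} I → b ◃ I → (↓ b) ≪ I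
  ◃⇒≪ I b◃I _ α _ I⊆∐α = ∥∥-bind
    (λ { (c , c∈I , ↓b⊆↓c) →
         ∥∥-map (λ { (j , c∈αj) → j , λ a a≺b → lower (proj₂ (α j)) (↓b⊆↓c a a≺b) c∈αj })
                (I⊆∐α c c∈I) })
    b◃I

  ≪⇒◃ : ∀ {b} I → (↓ b) ≪ I → b ◃ I
  ≪⇒◃ I ↓b≪I = ∥∥-map (λ { ((c , c∈I) , ↓b⊆↓c) → c , c∈I , ↓b⊆↓c })
    (↓b≪I _ (↓-members I) δ I⊆∐)
    where
    δ : IsDirected (↓-members I)
    δ = ↓-members-isDirected I
    I⊆∐ : I ⊆ ∐ (↓-members I) δ
    I⊆∐ = proj₂ (↓-members-isSup I) (∐ (↓-members I) δ) (∐-isUpperBound (↓-members I) δ)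

  ↓-≪-of-∈ : ∀ {b} I → b ∈ I → (↓ b) ≪ I
  ↓-≪-of-∈ {b} I b∈I = ◃⇒≪ I ∣ b , b∈I , (λ _ → id) ∣

  ≪-isProp : (∀ {a b} → Extensionality a b) → ∀ x y → isProp (x ≪ y)
  ≪-isProp fe x y f g = fe λ _ → fe λ _ → fe λ _ → fe λ _ → ∥∥-isProp _ _

  ◃↔≪ : (∀ {a b} → Extensionality a b) → ∀ b I → (b ◃ I) ↔ ((↓ b) ≪ I)
  ◃↔≪ fe b I = mk↔ₛ′ (◃⇒≪ I) (≪⇒◃ I) (λ _ → ≪-isProp fe (↓ b) I _ _) (λ _ → ∥∥-isProp _ _)

  ↓-way-below : (I : Ideal) → Σ[ b ∈ B ] ((↓ b) ≪ I) → Ideal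
  ↓-way-below I = ↓_ ∘ proj₁

  ↓-way-below-isDirected : (I : Ideal) → IsDirected (↓-way-below I)
  ↓-way-below-isDirected I = ∥∥-map (λ { (b , b∈I) → b , ↓-≪-of-∈ I b∈I }) (inhabited (proj₂ I))
                           , semidirected
    where
    semidirected : ∀ p q → ∃∥ _ (λ r → (↓-way-below I p ⊆ ↓-way-below I r)
                                        × (↓-way-below I q ⊆ ↓-way-below I r))
    semidirected (b₁ , w₁) (b₂ , w₂) =
      ∥∥-bind (λ { (c₁ , c₁∈I , ↓b₁⊆↓c₁) → ∥∥-bind (λ { (c₂ , c₂∈I , ↓b₂⊆↓c₂) →
        ∥∥-map (λ { (c , c∈I , c₁≺c , c₂≺c) →
                     (c , ↓-≪-of-∈ I c∈I)
                   , (λ a → ↓-mono c₁≺c a ∘ ↓b₁⊆↓c₁ a)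
                   , (λ a → ↓-mono c₂≺c a ∘ ↓b₂⊆↓c₂ a) })
               (directed (proj₂ I) c₁∈I c₂∈I) })
        (≪⇒◃ I w₂) }) (≪⇒◃ I w₁)

  ↓-way-below-isSup : (I : Ideal) → IsSup I (↓-way-below I)
  ↓-way-below-isSup I = upper , λ J ub → proj₂ (↓-members-isSup I) J
                                          (λ { (c , c∈I) → ub (c , ↓-≪-of-∈ I c∈I) })
    where
    upper : IsUpperBound I (↓-way-below I)
    upper (b , ↓b≪I) a a≺b = ∥∥-rec (prop-valued (proj₂ I) a)
      (λ { (c , c∈I , ↓b⊆↓c) → ↓-⊆-ideal I c∈I a (↓b⊆↓c a a≺b) }) (≪⇒◃ I ↓b≪I)

  ↓-isSmallBasis : (∀ {a b} → Extensionality a b) → IsSmallBasis ↓_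
  ↓-isSmallBasis fe = (λ I → ↓-way-below-isDirected I , ↓-way-below-isSup I)
                    , λ b I → b ◃ I , ◃↔≪ fe b I

  continuityData : ContinuityData
  continuityData I = Members I , ↓-members I , ↓-members-isDirected I , ↓-members-isSup I
                   , λ { (c , c∈I) → ↓-≪-of-∈ I c∈I }

theorem6p11 : (pt : PropTrunc) → (fe : ∀ {a b} → Extensionality a b) →
              ∀ {𝓥} (AB : Generic.AbstractBasis pt 𝓥) →
              Generic.Idl.IsSmallBasis pt AB (Generic.Idl.↓_ pt AB)
                × Generic.Idl.IsContinuous pt AB
theorem6p11 pt fe AB = ↓-isSmallBasis fe , PropTrunc.∣ pt ∣ continuityData
  where open RoundedIdealCompletion pt AB
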